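{- Let $M$ be an $m \times n$ matrix over $\{ -1,0,1\}$. If every row of $M$ is of the form $0^r1^s0^t$ or $0^r(-1)^s0^t$ for some $r,s,t\ge 0$, then the directed graph $G_o(M)$ is semi-transitive.
   Context: Rows of matrices are written as strings of length $n$; $x^r$ denotes the symbol $x$ repeated $r$ times. For an $m\times n$ matrix $M=[m_{ij}]$ over $\{ -1,0,1\}$, $G_o(M)$ is the directed graph on vertex set $\{1,\dots,n+m\}$ with edges $j\to i$ for all $1\le j<i\le n$, and for $1\le p\le m$, $1\le j\le n$: an edge $j\to n+p$ if $m_{pj}=1$, an edge $n+p\to j$ if $m_{pj}=-1$, no edge if $m_{pj}=0$; no edges among $n+1,\dots,n+m$. A directed graph is semi-transitive if it is acyclic and for every directed path $u_1\to\cdots\to u_t$, $t\ge2$, either there is no edge $u_1\to u_t$ or all edges $u_i\to u_j$ ($1\le i<j\le t$) exist. -}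

module Defs where

open import Data.Nat using (ℕ; zero; suc; _+_; _≤_; _<_)
open import Data.Fin using (Fin; toℕ; fromℕ)
open import Data.Sum using (_⊎_; inj₁; inj₂)
open import Data.Product using (Σ; ∃; _×_; _,_)
open import Data.Empty using (⊥)
open import Function.Definitions using (Injective)
open import Relation.Binary.PropositionalEquality using (_≡_)

data Entry : Set where
  neg zer pos : Entry   -- -1, 0, 1

-- An m × n matrix: M p j is the entry in row p, column j.
Matrix : ℕ → ℕ → Set
Matrix m n = Fin m → Fin n → Entry

-- Row p of M has the form 0^r x^s 0^t with x ∈ {1,-1}, r + s + t = n.
BlockRow : ∀ {n} → (Fin n → Entry) → Entry → Set
BlockRow {n} row x =
  Σ ℕ λ r → Σ ℕ λ s → (r + s ≤ n) ×
    ((j : Fin n) →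
       (toℕ j < r → row j ≡ zer) ×
       (r ≤ toℕ j → toℕ j < r + s → row j ≡ x) ×
       (r + s ≤ toℕ j → row j ≡ zer))

RowOfForm : ∀ {n} → (Fin n → Entry) → Set
RowOfForm row = BlockRow row pos ⊎ BlockRow row neg

-- The graph G_o(M). Vertex set {1..n+m} is represented as Fin n ⊎ Fin m:
-- inj₁ j is vertex j+1 (1..n), inj₂ p is vertex n+p+1.
Vertex : ℕ → ℕ → Set
Vertex m n = Fin n ⊎ Fin m

data Go {m n : ℕ} (M : Matrix m n) : Vertex m n → Vertex m n → Set where
  col→col : ∀ {j i : Fin n} → toℕ j < toℕ i → Go M (inj₁ j) (inj₁ i)
  col→row : ∀ {j : Fin n} {p : Fin m} → M p j ≡ pos → Go M (inj₁ j) (inj₂ p)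
  row→col : ∀ {j : Fin n} {p : Fin m} → M p j ≡ neg → Go M (inj₂ p) (inj₁ j)

IsWalk : ∀ {V : Set} → (V → V → Set) → ∀ {t} → (Fin t → V) → Set
IsWalk E {t} u = (i j : Fin t) → toℕ j ≡ suc (toℕ i) → E (u i) (u j)

IsPath : ∀ {V : Set} → (V → V → Set) → ∀ {t} → (Fin t → V) → Set
IsPath E u = IsWalk E u × Injective _≡_ _≡_ u

Acyclic : ∀ {V : Set} → (V → V → Set) → Set
Acyclic {V} E = ∀ s (u : Fin (suc (suc s)) → V) →
  IsWalk E u → u Fin.zero ≡ u (fromℕ (suc s)) → ⊥

SemiTransitive : ∀ {V : Set} → (V → V → Set) → Set
SemiTransitive {V} E = Acyclic E ×
  (∀ s (u : Fin (suc (suc s)) → V) → IsPath E u →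
     (E (u Fin.zero) (u (fromℕ (suc s))) → ⊥) ⊎
     ((i j : Fin (suc (suc s))) → toℕ i < toℕ j → E (u i) (u j)))

-- Give column j the height j, a row 0^r 1^s 0^t the height n + 1 and a row 0^r (-1)^s 0^t the
-- height 0. Every edge of G_o(M) raises the height, so G_o(M) is acyclic, the columns along a walk
-- increase, and a row (of height 0 or n + 1) can only be the first or the last vertex of a walk.
-- Given a walk u_1 → ⋯ → u_t with the shortcut u_1 → u_t, two of its columns are always joined;
-- a row at u_1 is joined to the columns u_2 and u_t (by the walk and the shortcut), hence, its
-- nonzero entries forming an interval, to every column in between; dually for a row at u_t.
module Submission where

open import Defs
open import Data.Nat using (ℕ; suc; _+_; _≤_; _<_; z≤n; s≤s; _<?_)
open import Data.Nat.Properties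
  using (<-trans; <⇒≤; ≤-refl; ≤-trans; ≤-<-trans; ≤-pred; <⇒≱; ≮⇒≥; n≮0; <-irrefl; m≤n⇒m<n∨m≡n)
open import Data.Fin using (Fin; toℕ; fromℕ; inject₁)
open import Data.Fin.Properties using (toℕ-injective; toℕ<n; toℕ-inject₁; ≤fromℕ)
open import Data.Sum using (_⊎_; inj₁; inj₂)
open import Data.Product using (∃; _×_; _,_; proj₁; proj₂)
open import Data.Empty using (⊥-elim)
open import Function using (_∘_)
open import Relation.Nullary using (yes; no; ¬_)
open import Relation.Binary.Definitions using (DecidableEquality; Decidable)
open import Relation.Binary.PropositionalEquality using (_≡_; _≢_; refl; sym; trans; cong; subst; subst₂)

_≟ₑ_ : DecidableEquality Entry
neg ≟ₑ neg = yes refl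
zer ≟ₑ zer = yes refl
pos ≟ₑ pos = yes refl
neg ≟ₑ zer = no λ ()
neg ≟ₑ pos = no λ ()
zer ≟ₑ neg = no λ ()
zer ≟ₑ pos = no λ ()
pos ≟ₑ neg = no λ ()
pos ≟ₑ zer = no λ ()

module _ {n} {row : Fin n → Entry} {x : Entry} where

  blockRow-nonzero : BlockRow row x → ∀ {j y} → row j ≡ y → y ≢ zer → y ≡ x
  blockRow-nonzero (r , s , _ , entries) {j} e y≢0 with entries j | toℕ j <? r | toℕ j <? r + s
  ... | before , _ , _ | yes j<r | _        = ⊥-elim (y≢0 (trans (sym e) (before j<r)))
  ... | _ , inside , _ | no j≮r | yes j<r+s = trans (sym e) (inside (≮⇒≥ j≮r) j<r+s)
  ... | _ , _ , after  | no _   | no j≮r+s  = ⊥-elim (y≢0 (trans (sym e) (after (≮⇒≥ j≮r+s))))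

  blockRow-convex : BlockRow row x → x ≢ zer → ∀ {a b c} → row a ≡ x → row b ≡ x →
                    toℕ a ≤ toℕ c → toℕ c ≤ toℕ b → row c ≡ x
  blockRow-convex (r , s , _ , entries) x≢0 {c = c} ea eb a≤c c≤b =
    proj₁ (proj₂ (entries c)) (≤-trans (start≤ ea) a≤c) (≤-<-trans c≤b (<end eb))
    where
    start≤ : ∀ {j} → row j ≡ x → r ≤ toℕ j
    start≤ {j} e with toℕ j <? r
    ... | yes j<r = ⊥-elim (x≢0 (trans (sym e) (proj₁ (entries j) j<r)))
    ... | no j≮r  = ≮⇒≥ j≮r
    <end : ∀ {j} → row j ≡ x → toℕ j < r + s
    <end {j} e with toℕ j <? r + s
    ... | yes j<r+s = j<r+s
    ... | no j≮r+s  = ⊥-elim (x≢0 (trans (sym e) (proj₂ (proj₂ (entries j)) (≮⇒≥ j≮r+s))))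

rowOfForm-pos : ∀ {n} {row : Fin n → Entry} → RowOfForm row → ∀ {j} → row j ≡ pos → BlockRow row pos
rowOfForm-pos (inj₁ block) _ = block
rowOfForm-pos (inj₂ block) e with blockRow-nonzero block e (λ ())
... | ()

rowOfForm-neg : ∀ {n} {row : Fin n → Entry} → RowOfForm row → ∀ {j} → row j ≡ neg → BlockRow row neg
rowOfForm-neg (inj₁ block) e with blockRow-nonzero block e (λ ())
... | ()
rowOfForm-neg (inj₂ block) _ = block

module GradedWalk {V : Set} {E : V → V → Set} (h : V → ℕ)
                  (h-increasing : ∀ {a b} → E a b → h a < h b) where

  private
    walk-tail : ∀ {t} {u : Fin (suc t) → V} → IsWalk E u → IsWalk E (u ∘ Fin.suc)
    walk-tail walk i j j≡1+i = walk (Fin.suc i) (Fin.suc j) (cong suc j≡1+i)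

  walk-increasing : ∀ {t} {u : Fin t → V} → IsWalk E u → ∀ {i j} → toℕ i < toℕ j → h (u i) < h (u j)
  walk-increasing walk {Fin.zero} {Fin.suc Fin.zero} _ = h-increasing (walk Fin.zero (Fin.suc Fin.zero) refl)
  walk-increasing walk {Fin.zero} {Fin.suc (Fin.suc j)} _ =
    <-trans (h-increasing (walk Fin.zero (Fin.suc Fin.zero) refl))
            (walk-increasing (walk-tail walk) {Fin.zero} {Fin.suc j} (s≤s z≤n))
  walk-increasing walk {Fin.suc i} {Fin.suc j} (s≤s i<j) = walk-increasing (walk-tail walk) i<j

  walk-nondecreasing : ∀ {t} {u : Fin t → V} → IsWalk E u → ∀ {i j} → toℕ i ≤ toℕ j → h (u i) ≤ h (u j)
  walk-nondecreasing walk i≤j with m≤n⇒m<n∨m≡n i≤j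
  ... | inj₁ i<j = <⇒≤ (walk-increasing walk i<j)
  ... | inj₂ i≡j rewrite toℕ-injective i≡j = ≤-refl

  walk-height-zero⇒first : ∀ {t} {u : Fin (suc t) → V} → IsWalk E u → ∀ {i} → h (u i) ≡ 0 → i ≡ Fin.zero
  walk-height-zero⇒first walk {Fin.zero} _ = refl
  walk-height-zero⇒first {u = u} walk {Fin.suc i} hᵢ≡0 =
    ⊥-elim (n≮0 (subst (h (u Fin.zero) <_) hᵢ≡0 (walk-increasing walk (s≤s z≤n))))

  walk-height-max⇒last : ∀ {t} {u : Fin (suc t) → V} → IsWalk E u → ∀ {B} → (∀ v → h v ≤ B) →
                         ∀ {j} → h (u j) ≡ B → j ≡ fromℕ t
  walk-height-max⇒last {t} {u} walk bounded {j} hⱼ≡B with m≤n⇒m<n∨m≡n (≤fromℕ j)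
  ... | inj₁ j<last =
    ⊥-elim (<⇒≱ (subst (_< h (u (fromℕ t))) hⱼ≡B (walk-increasing walk j<last)) (bounded _))
  ... | inj₂ j≡last = toℕ-injective j≡last

  acyclic : Acyclic E
  acyclic s u walk u₀≡uₗ = <-irrefl (cong h u₀≡uₗ) (walk-increasing walk (s≤s z≤n))

module _ {m n} (M : Matrix m n) where

  Go? : Decidable (Go M)
  Go? (inj₁ j) (inj₁ i) with toℕ j <? toℕ i
  ... | yes j<i = yes (col→col j<i)
  ... | no j≮i  = no λ { (col→col j<i) → j≮i j<i }
  Go? (inj₁ j) (inj₂ p) with M p j ≟ₑ pos
  ... | yes e = yes (col→row e)
  ... | no ¬e = no λ { (col→row e) → ¬e e }
  Go? (inj₂ p) (inj₁ j) with M p j ≟ₑ neg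
  ... | yes e = yes (row→col e)
  ... | no ¬e = no λ { (row→col e) → ¬e e }
  Go? (inj₂ p) (inj₂ q) = no λ ()

  Go-into-row : ∀ {v p} → Go M v (inj₂ p) → ∃ λ c → v ≡ inj₁ c × M p c ≡ pos
  Go-into-row (col→row e) = _ , refl , e

  Go-out-of-row : ∀ {v p} → Go M (inj₂ p) v → ∃ λ c → v ≡ inj₁ c × M p c ≡ neg
  Go-out-of-row (row→col e) = _ , refl , e

module _ {m n} (M : Matrix m n) (rows : (p : Fin m) → RowOfForm (M p)) where

  height : Vertex m n → ℕ
  height (inj₁ j) = suc (toℕ j)
  height (inj₂ p) with rows p
  ... | inj₁ _ = suc n
  ... | inj₂ _ = 0

  height-bounded : ∀ v → height v ≤ suc n
  height-bounded (inj₁ j) = s≤s (<⇒≤ (toℕ<n j))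
  height-bounded (inj₂ p) with rows p
  ... | inj₁ _ = ≤-refl
  ... | inj₂ _ = z≤n

  height-row : ∀ p → height (inj₂ p) ≡ 0 ⊎ height (inj₂ p) ≡ suc n
  height-row p with rows p
  ... | inj₁ _ = inj₂ refl
  ... | inj₂ _ = inj₁ refl

  Go-height-increasing : ∀ {a b} → Go M a b → height a < height b
  Go-height-increasing (col→col j<i) = s≤s j<i
  Go-height-increasing (col→row {j} {p} e) with rows p
  ... | inj₁ _     = s≤s (toℕ<n j)
  ... | inj₂ block with blockRow-nonzero block e (λ ())
  ...   | ()
  Go-height-increasing (row→col {p = p} e) with rows p
  ... | inj₂ _     = s≤s z≤n
  ... | inj₁ block with blockRow-nonzero block e (λ ())
  ...   | ()

  open GradedWalk {E = Go M} height Go-height-increasing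

  Go-acyclic : Acyclic (Go M)
  Go-acyclic = acyclic

  module _ {s} {u : Fin (suc (suc s)) → Vertex m n} (walk : IsWalk (Go M) u)
           (shortcut : Go M (u Fin.zero) (u (fromℕ (suc s)))) where

    private
      last penultimate : Fin (suc (suc s))
      last = fromℕ (suc s)
      penultimate = inject₁ (fromℕ s)

      first-edge : Go M (u Fin.zero) (u (Fin.suc Fin.zero))
      first-edge = walk Fin.zero (Fin.suc Fin.zero) refl

      last-edge : Go M (u penultimate) (u last)
      last-edge = walk penultimate last (cong suc (sym (toℕ-inject₁ (fromℕ s))))

      increasing : ∀ {i j} → toℕ i < toℕ j → height (u i) < height (u j)
      increasing = walk-increasing {u = u} walk

      height-order : ∀ {i j v w} → u i ≡ v → u j ≡ w → toℕ i < toℕ j → height v < height w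
      height-order uᵢ uⱼ i<j = subst₂ (λ v w → height v < height w) uᵢ uⱼ (increasing i<j)

      column-order : ∀ {i j a b} → u i ≡ inj₁ a → u j ≡ inj₁ b → toℕ i ≤ toℕ j → toℕ a ≤ toℕ b
      column-order uᵢ uⱼ i≤j =
        ≤-pred (subst₂ (λ v w → height v ≤ height w) uᵢ uⱼ (walk-nondecreasing {u = u} walk i≤j))

    row-first : ∀ {i j p} → u i ≡ inj₂ p → toℕ i < toℕ j → i ≡ Fin.zero
    row-first {j = j} {p = p} uᵢ i<j with height-row p
    ... | inj₁ h≡0 = walk-height-zero⇒first {u = u} walk (trans (cong height uᵢ) h≡0)
    ... | inj₂ h≡top =
      ⊥-elim (<⇒≱ (subst (_< height (u j)) (trans (cong height uᵢ) h≡top) (increasing i<j))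
                  (height-bounded (u j)))

    row-last : ∀ {i j q} → u j ≡ inj₂ q → toℕ i < toℕ j → j ≡ last
    row-last {i} {q = q} uⱼ i<j with height-row q
    ... | inj₁ h≡0   = ⊥-elim (n≮0 (subst (height (u i) <_) (trans (cong height uⱼ) h≡0) (increasing i<j)))
    ... | inj₂ h≡top =
      walk-height-max⇒last {u = u} walk height-bounded (trans (cong height uⱼ) h≡top)

    edge-from-first-row : ∀ {i j p c} → u i ≡ inj₂ p → u j ≡ inj₁ c → toℕ i < toℕ j →
                          Go M (inj₂ p) (inj₁ c)
    edge-from-first-row {p = p} uᵢ uⱼ i<j with row-first uᵢ i<j
    ... | refl with Go-out-of-row M (subst (λ v → Go M v (u (Fin.suc Fin.zero))) uᵢ first-edge)
                  | Go-out-of-row M (subst (λ v → Go M v (u last)) uᵢ shortcut)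
    ...   | c₁ , u₁ , e₁ | cₗ , uₗ , eₗ =
      row→col (blockRow-convex (rowOfForm-neg (rows p) e₁) (λ ()) e₁ eₗ
                 (column-order u₁ uⱼ i<j) (column-order uⱼ uₗ (≤fromℕ _)))

    edge-into-last-row : ∀ {i j a q} → u i ≡ inj₁ a → u j ≡ inj₂ q → toℕ i < toℕ j →
                         Go M (inj₁ a) (inj₂ q)
    edge-into-last-row {i} {q = q} uᵢ uⱼ i<j with row-last uⱼ i<j
    ... | refl with Go-into-row M (subst (Go M (u Fin.zero)) uⱼ shortcut)
                  | Go-into-row M (subst (Go M (u penultimate)) uⱼ last-edge)
    ...   | c₀ , u₀ , e₀ | cₚ , uₚ , eₚ =
      col→row (blockRow-convex (rowOfForm-pos (rows q) e₀) (λ ()) e₀ eₚ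
                 (column-order u₀ uᵢ z≤n) (column-order uᵢ uₚ i≤penultimate))
      where
      i≤penultimate : toℕ i ≤ toℕ penultimate
      i≤penultimate = subst (toℕ i ≤_) (sym (toℕ-inject₁ (fromℕ s))) (≤-pred i<j)

    shortcut-transitive : ∀ {i j} → toℕ i < toℕ j → Go M (u i) (u j)
    shortcut-transitive {i} {j} i<j with u i in uᵢ | u j in uⱼ
    ... | inj₁ a | inj₁ b = col→col (≤-pred (height-order uᵢ uⱼ i<j))
    ... | inj₁ a | inj₂ q = edge-into-last-row uᵢ uⱼ i<j
    ... | inj₂ p | inj₁ c = edge-from-first-row uᵢ uⱼ i<j
    ... | inj₂ p | inj₂ q with row-first uᵢ i<j | row-last uⱼ i<j
    ...   | refl | refl with subst₂ (Go M) uᵢ uⱼ shortcut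
    ...     | ()

corollary2p15 : (m n : ℕ) (M : Matrix m n) →
    ((p : Fin m) → RowOfForm (M p)) →
    SemiTransitive (Go M)
corollary2p15 m n M rows = Go-acyclic M rows , closes
  where
  closes : ∀ s (u : Fin (suc (suc s)) → Vertex m n) → IsPath (Go M) u →
           ¬ Go M (u Fin.zero) (u (fromℕ (suc s))) ⊎ (∀ i j → toℕ i < toℕ j → Go M (u i) (u j))
  closes s u (walk , _) with Go? M (u Fin.zero) (u (fromℕ (suc s)))
  ... | no ¬shortcut = inj₁ ¬shortcut
  ... | yes shortcut = inj₂ λ i j → shortcut-transitive M rows walk shortcut
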